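{- The following statements are equivalent. (i) Every $5$-edge-connected $5$-graph is class $1$. (ii) Every $5$-edge-connected $5$-graph whose underlying simple graph is cubic is class $1$.
   Context: Graphs are finite, may have parallel edges, but no loops. The underlying graph of $G$ is the simple graph on $V(G)$ in which $u,v$ are adjacent iff they are joined by at least one edge of $G$. An $r$-graph is an $r$-regular graph in which every vertex set of odd cardinality is joined to its complement by at least $r$ edges; $r$-edge-connected means every nonempty proper vertex subset is joined to its complement by at least $r$ edges. An $r$-regular graph is class 1 if it has $r$ pairwise disjoint perfect matchings, and class 2 otherwise. -}

module Defs where

open import Data.Nat using (ℕ; zero; suc; _+_; _≤_; _%_)
open import Data.Bool using (Bool; true; false; _∨_; _∧_; _xor_)
open import Data.Fin using (Fin; zero; suc; _≟_)
open import Data.Fin.Subset using (Subset; ∣_∣; Nonempty; ∁; _∈_)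
open import Data.Fin.Subset.Properties using (_∈?_)
open import Data.Fin.Properties using (any?)
open import Data.Product using (Σ; ∃; _×_; _,_; proj₁; proj₂)
open import Data.Sum using (_⊎_)
open import Relation.Nullary using (¬_; Dec; does)
open import Relation.Nullary.Decidable using (_⊎-dec_; _×-dec_)
open import Relation.Binary.PropositionalEquality using (_≡_; _≢_)

bool→ℕ : Bool → ℕ
bool→ℕ true  = 1
bool→ℕ false = 0

count : (m : ℕ) → (Fin m → Bool) → ℕ
count zero    p = 0
count (suc m) p = bool→ℕ (p zero) + count m (λ i → p (suc i))

record Multigraph : Set where
  field
    n      : ℕ
    m      : ℕ
    ends   : Fin m → Fin n × Fin n
    noLoop : (e : Fin m) → proj₁ (ends e) ≢ proj₂ (ends e)

module _ (G : Multigraph) where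
  open Multigraph G

  incident : Fin m → Fin n → Bool
  incident e v = does (v ≟ proj₁ (ends e)) ∨ does (v ≟ proj₂ (ends e))

  degree : Fin n → ℕ
  degree v = count m (λ e → incident e v)

  Regular : ℕ → Set
  Regular r = (v : Fin n) → degree v ≡ r

  cutSize : Subset n → ℕ
  cutSize S = count m (λ e → does (proj₁ (ends e) ∈? S) xor does (proj₂ (ends e) ∈? S))

  IsRGraph : ℕ → Set
  IsRGraph r = Regular r × ((S : Subset n) → ∣ S ∣ % 2 ≡ 1 → r ≤ cutSize S)

  EdgeConnected : ℕ → Set
  EdgeConnected r = (S : Subset n) → Nonempty S → Nonempty (∁ S) → r ≤ cutSize S

  PerfectMatching : Subset m → Set
  PerfectMatching M = (v : Fin n) → count m (λ e → does (e ∈? M) ∧ incident e v) ≡ 1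

  Class1 : ℕ → Set
  Class1 r = Σ (Fin r → Subset m) λ Ms →
               ((i : Fin r) → PerfectMatching (Ms i)) ×
               ((i j : Fin r) → i ≢ j → (e : Fin m) → ¬ (e ∈ Ms i × e ∈ Ms j))

  Adjacent : Fin n → Fin n → Set
  Adjacent u v = ∃ λ (e : Fin m) → (proj₁ (ends e) ≡ u × proj₂ (ends e) ≡ v)
                                  ⊎ (proj₁ (ends e) ≡ v × proj₂ (ends e) ≡ u)

  adjacent? : (u v : Fin n) → Dec (Adjacent u v)
  adjacent? u v = any? λ e → ((proj₁ (ends e) ≟ u) ×-dec (proj₂ (ends e) ≟ v))
                       ⊎-dec ((proj₁ (ends e) ≟ v) ×-dec (proj₂ (ends e) ≟ u))

  simpleDegree : Fin n → ℕ
  simpleDegree u = count n (λ v → does (adjacent? u v))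

  UnderlyingCubic : Set
  UnderlyingCubic = (v : Fin n) → simpleDegree v ≡ 3

-- Only (ii) ⇒ (i) needs work. Given a 5-edge-connected 5-graph G, replace every vertex v by a
-- pentagon with doubled sides and attach the five edges at v to its five corners. The result G′ is
-- 5-regular and its underlying simple graph is cubic. A cut of G′ that splits every pentagon has at
-- least 4 inner edges per pentagon; otherwise some pentagon lies on one side, and the cut is at least
-- the cut of G formed by the pentagons meeting one side, hence at least 5. As G′ has even order it is
-- a 5-graph. Finally, five disjoint perfect matchings of G′ partition its edges, and each meets a
-- pentagon in an even number of inner edge ends, so it contains an odd number, hence exactly one, of
-- the five edges at v: restricted to the edges of G they are perfect matchings of G.

module Submission where

open import Defs
open import Data.Bool using (Bool; true; false; not; _∨_; _∧_; _xor_; if_then_else_)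
open import Data.Bool.Properties using (xor-comm; ∧-zeroʳ; ∧-identityʳ; ∨-identityʳ; ∨-zeroʳ; ∧-distribˡ-∨; ∧-assoc)
open import Data.Empty using (⊥; ⊥-elim)
open import Data.Fin.Subset using (Subset; _∈_; ∁; Nonempty; ∣_∣; ⊤)
open import Data.Fin.Subset.Properties
  using (_∈?_; anySubset?; ∈⊤; x∈∁p⇒x∉p; x∉p⇒x∈∁p; x∉∁p⇒x∈p; nonempty?; Empty-unique; ∣⊥∣≡0; ∣⊤∣≡n; ⊆-antisym)
open import Data.Fin using (Fin; zero; suc; _≟_; _↑ˡ_; _↑ʳ_; combine; remQuot; splitAt; join; toℕ)
open import Data.Fin.Properties
  using (combine-injectiveˡ; combine-injectiveʳ; remQuot-combine; combine-remQuot; splitAt-↑ˡ; splitAt-↑ʳ; join-splitAt;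
         toℕ-injective; toℕ<n; any?)
  renaming (suc-injective to fsuc-injective)
open import Data.Nat using (ℕ; zero; suc; _+_; _*_; _≤_; _<_; z≤n; s≤s; _%_; _≤?_)
open import Data.Nat.DivMod using (m%n<n; %-distribˡ-*)
open import Data.Nat.Properties
  using (+-0-commutativeMonoid; ≤-trans; ≤-reflexive; ≤-antisym; +-mono-≤; +-monoʳ-≤; +-monoˡ-≤;
         +-cancelˡ-≤; +-cancelʳ-≤; +-monoʳ-<; +-cancelˡ-≡; m≤m+n; m≤n+m; +-identityʳ; +-assoc; +-commutativeSemigroup; *-identityʳ; *-monoˡ-≤; *-monoʳ-≤;
         even≢odd; module ≤-Reasoning)
open import Data.Vec using (lookup; tabulate)
open import Data.Vec.Properties using (lookup∘tabulate; []=⇒lookup; lookup⇒[]=)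
open import Data.Product using (∃; _×_; _,_; proj₁; proj₂)
open import Data.Sum using (_⊎_; inj₁; inj₂; [_,_]′)
open import Function using (_∘_; _⇔_; mk⇔)
open import Relation.Nullary using (¬_; Dec; yes; no; does; contradiction)
open import Relation.Nullary.Decidable
  using (dec-true; dec-false; map′; ¬?; _→-dec_; decidable-stable; from-yes)
open import Relation.Binary.PropositionalEquality

open import Algebra.Properties.CommutativeSemigroup +-commutativeSemigroup using (x∙yz≈y∙xz)
open import Algebra.Properties.CommutativeMonoid.Sum +-0-commutativeMonoid
  using (sum; sum-syntax; sum-cong-≗; ∑-distrib-+; ∑-comm; sum-replicate-zero)

count≡∑ : ∀ N (p : Fin N → Bool) → count N p ≡ ∑[ i < N ] bool→ℕ (p i)
count≡∑ zero    p = refl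
count≡∑ (suc N) p = cong (bool→ℕ (p zero) +_) (count≡∑ N (p ∘ suc))

count-cong : ∀ N {p q : Fin N → Bool} → (∀ i → p i ≡ q i) → count N p ≡ count N q
count-cong N {p} {q} p≗q = begin
  count N p                    ≡⟨ count≡∑ N p ⟩
  ∑[ i < N ] bool→ℕ (p i)      ≡⟨ sum-cong-≗ (cong bool→ℕ ∘ p≗q) ⟩
  ∑[ i < N ] bool→ℕ (q i)      ≡⟨ count≡∑ N q ⟨
  count N q                    ∎
  where open ≡-Reasoning

∑-zero : ∀ {N} (f : Fin N → ℕ) → (∀ i → f i ≡ 0) → sum f ≡ 0
∑-zero {N} f f≗0 = trans (sum-cong-≗ f≗0) (sum-replicate-zero N)

∑-mono-≤ : ∀ {N} {f g : Fin N → ℕ} → (∀ i → f i ≤ g i) → sum f ≤ sum g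
∑-mono-≤ {zero}  f≤g = z≤n
∑-mono-≤ {suc N} f≤g = +-mono-≤ (f≤g zero) (∑-mono-≤ (f≤g ∘ suc))

∑-supported : ∀ {N} (f : Fin N → ℕ) (a : Fin N) → (∀ i → i ≢ a → f i ≡ 0) → sum f ≡ f a
∑-supported {suc N} f zero    off =
  trans (cong (f zero +_) (∑-zero (f ∘ suc) (λ i → off (suc i) λ ()))) (+-identityʳ (f zero))
∑-supported {suc N} f (suc a) off =
  cong₂ _+_ (off zero λ ()) (∑-supported (f ∘ suc) a (λ i i≢a → off (suc i) (i≢a ∘ fsuc-injective)))

∑-↑ : ∀ A B (f : Fin (A + B) → ℕ) → sum f ≡ ∑[ i < A ] f (i ↑ˡ B) + ∑[ j < B ] f (A ↑ʳ j)
∑-↑ zero    B f = refl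
∑-↑ (suc A) B f = trans (cong (f zero +_) (∑-↑ A B (f ∘ suc))) (sym (+-assoc (f zero) _ _))

∑-combine : ∀ A B (f : Fin (A * B) → ℕ) → sum f ≡ ∑[ a < A ] ∑[ b < B ] f (combine a b)
∑-combine zero    B f = refl
∑-combine (suc A) B f =
  trans (∑-↑ B (A * B) f) (cong (∑[ j < B ] f (j ↑ˡ (A * B)) +_) (∑-combine A B (f ∘ (B ↑ʳ_))))

∑-≥-const : ∀ {N} k (f : Fin N → ℕ) → (∀ i → k ≤ f i) → N * k ≤ sum f
∑-≥-const {zero}  k f k≤f = z≤n
∑-≥-const {suc N} k f k≤f = +-mono-≤ (k≤f zero) (∑-≥-const k (f ∘ suc) (k≤f ∘ suc))

count≡1 : ∀ N (p : Fin N → Bool) (e : Fin N) → p e ≡ true → (∀ f → p f ≡ true → f ≡ e) → count N p ≡ 1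
count≡1 N p e pe unique = trans (count≡∑ N p) (trans (∑-supported _ e off) (cong bool→ℕ pe))
  where
  off : ∀ f → f ≢ e → bool→ℕ (p f) ≡ 0
  off f f≢e with p f in pf
  ... | true  = contradiction (unique f pf) f≢e
  ... | false = refl

∑-pairwiseDisjoint≤1 : ∀ {N} (p : Fin N → Bool) → (∀ i j → i ≢ j → p i ≡ true → p j ≡ true → ⊥) →
                       ∑[ i < N ] bool→ℕ (p i) ≤ 1
∑-pairwiseDisjoint≤1 {zero}  p disjoint = z≤n
∑-pairwiseDisjoint≤1 {suc N} p disjoint with p zero in p0
... | true  = ≤-reflexive (cong suc (∑-zero _ rest≡0))
  where
  rest≡0 : ∀ i → bool→ℕ (p (suc i)) ≡ 0
  rest≡0 i with p (suc i) in pi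
  ... | true  = ⊥-elim (disjoint zero (suc i) (λ ()) p0 pi)
  ... | false = refl
... | false = ∑-pairwiseDisjoint≤1 (p ∘ suc) (λ i j i≢j → disjoint (suc i) (suc j) (i≢j ∘ fsuc-injective))

∑-positive≤length⇒≡1 : ∀ {N} (c : Fin N → ℕ) → (∀ j → 1 ≤ c j) → sum c ≤ N → ∀ j → c j ≡ 1
∑-positive≤length⇒≡1 {suc N} c c≥1 ∑c≤N = go
  where
  rest≥N : N ≤ ∑[ i < N ] c (suc i)
  rest≥N = subst (_≤ ∑[ i < N ] c (suc i)) (*-identityʳ N) (∑-≥-const 1 (c ∘ suc) (c≥1 ∘ suc))
  go : ∀ j → c j ≡ 1
  go zero    = ≤-antisym (+-cancelʳ-≤ N (c zero) 1 (≤-trans (+-monoʳ-≤ (c zero) rest≥N) ∑c≤N)) (c≥1 zero)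
  go (suc j) = ∑-positive≤length⇒≡1 (c ∘ suc) (c≥1 ∘ suc) (+-cancelˡ-≤ 1 _ N (≤-trans (+-monoˡ-≤ _ (c≥1 zero)) ∑c≤N)) j

does⇒ : ∀ {A : Set} (a? : Dec A) → does a? ≡ true → A
does⇒ (yes a) _ = a

does⇒¬ : ∀ {A : Set} (a? : Dec A) → does a? ≡ false → ¬ A
does⇒¬ (no ¬a) _ = ¬a

does-≡ : ∀ {A : Set} (a? : Dec A) {b : Bool} → (A → b ≡ true) → (b ≡ true → A) → does a? ≡ b
does-≡ (yes a) {true}  _ _ = refl
does-≡ (yes a) {false} to _ = sym (to a)
does-≡ (no ¬a) {true}  _ from = contradiction (from refl) ¬a
does-≡ (no ¬a) {false} _ _ = refl

∧-≡true : ∀ {x y} → x ∧ y ≡ true → x ≡ true × y ≡ true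
∧-≡true {true} {true} _ = refl , refl

∨-introˡ : ∀ {x y} → x ≡ true → x ∨ y ≡ true
∨-introˡ refl = refl

∨-introʳ : ∀ {x y} → y ≡ true → x ∨ y ≡ true
∨-introʳ {x} refl = ∨-zeroʳ x

∨-≡true : ∀ {x y} → x ∨ y ≡ true → x ≡ true ⊎ y ≡ true
∨-≡true {true}  _   = inj₁ refl
∨-≡true {false} y≡t = inj₂ y≡t

≟-refl : ∀ {N} (x : Fin N) → does (x ≟ x) ≡ true
≟-refl x = dec-true (x ≟ x) refl

combine-≟ : ∀ {A B} (v u : Fin A) (i j : Fin B) → does (combine v i ≟ combine u j) ≡ does (v ≟ u) ∧ does (i ≟ j)
combine-≟ v u i j with v ≟ u | i ≟ j
... | yes refl | yes refl = ≟-refl (combine v i)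
... | yes refl | no i≢j   = dec-false (combine v i ≟ combine v j) (i≢j ∘ combine-injectiveʳ v i v j)
... | no v≢u   | _        = dec-false (combine v i ≟ combine u j) (v≢u ∘ combine-injectiveˡ v i u j)

∑-at : ∀ {N} (h : Fin N → Bool) (p : Fin N) → ∑[ x < N ] bool→ℕ (h x ∧ does (x ≟ p)) ≡ bool→ℕ (h p)
∑-at h p = trans (∑-supported _ p λ x x≢p → cong bool→ℕ (trans (cong (h x ∧_) (dec-false (x ≟ p) x≢p)) (∧-zeroʳ (h x))))
                 (cong bool→ℕ (trans (cong (h p ∧_) (≟-refl p)) (∧-identityʳ (h p))))

∑-∧-count≡1 : ∀ N (p : Fin N → Bool) (b : Bool) → count N p ≡ 1 → ∑[ e < N ] bool→ℕ (b ∧ p e) ≡ bool→ℕ b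
∑-∧-count≡1 N p true  count≡1 = trans (sym (count≡∑ N p)) count≡1
∑-∧-count≡1 N p false _       = ∑-zero (λ e → bool→ℕ (false ∧ p e)) λ _ → refl

∑-twoPoints : ∀ {N} (h : Fin N → Bool) {p q : Fin N} → p ≢ q →
              ∑[ x < N ] bool→ℕ (h x ∧ (does (x ≟ p) ∨ does (x ≟ q))) ≡ bool→ℕ (h p) + bool→ℕ (h q)
∑-twoPoints {N} h {p} {q} p≢q =
  trans (sum-cong-≗ split) (trans (∑-distrib-+ (λ x → bool→ℕ (h x ∧ does (x ≟ p))) _) (cong₂ _+_ (∑-at h p) (∑-at h q)))
  where
  split : ∀ x → bool→ℕ (h x ∧ (does (x ≟ p) ∨ does (x ≟ q))) ≡ bool→ℕ (h x ∧ does (x ≟ p)) + bool→ℕ (h x ∧ does (x ≟ q))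
  split x with x ≟ p | x ≟ q
  ... | yes refl | yes refl = contradiction refl p≢q
  ... | yes _    | no  _    = sym (trans (cong (bool→ℕ (h x ∧ true) +_) (cong bool→ℕ (∧-zeroʳ (h x)))) (+-identityʳ _))
  ... | no  _    | x≟q      = sym (cong (λ b → bool→ℕ b + bool→ℕ (h x ∧ does x≟q)) (∧-zeroʳ (h x)))

isOneOf : ∀ {N} → Fin N → Fin N → Fin N → Fin N → Bool
isOneOf A B C z = does (z ≟ A) ∨ (does (z ≟ B) ∨ does (z ≟ C))

isOneOf-first : ∀ {N} (A B C : Fin N) → isOneOf A B C A ≡ true
isOneOf-first A B C = ∨-introˡ (≟-refl A)

isOneOf-second : ∀ {N} (A B C : Fin N) → isOneOf A B C B ≡ true
isOneOf-second A B C = ∨-introʳ {does (B ≟ A)} (∨-introˡ {y = does (B ≟ C)} (≟-refl B))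

isOneOf-third : ∀ {N} (A B C : Fin N) → isOneOf A B C C ≡ true
isOneOf-third A B C = ∨-introʳ {does (C ≟ A)} (∨-introʳ {does (C ≟ B)} (≟-refl C))

count-isOneOf : ∀ {N} {A B C : Fin N} → A ≢ B → A ≢ C → B ≢ C → count N (isOneOf A B C) ≡ 3
count-isOneOf {N} {A} {B} {C} A≢B A≢C B≢C = begin
  count N (isOneOf A B C)
    ≡⟨ count≡∑ N (isOneOf A B C) ⟩
  ∑[ z < N ] bool→ℕ (isOneOf A B C z)
    ≡⟨ sum-cong-≗ split ⟩
  ∑[ z < N ] (is A z + (is B z + is C z))
    ≡⟨ trans (∑-distrib-+ (is A) _) (cong (sum (is A) +_) (∑-distrib-+ (is B) (is C))) ⟩
  sum (is A) + (sum (is B) + sum (is C))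
    ≡⟨ cong₂ _+_ (∑-at (λ _ → true) A) (cong₂ _+_ (∑-at (λ _ → true) B) (∑-at (λ _ → true) C)) ⟩
  3 ∎
  where
  open ≡-Reasoning
  is : Fin N → Fin N → ℕ
  is X z = bool→ℕ (does (z ≟ X))
  split : ∀ z → bool→ℕ (isOneOf A B C z) ≡ is A z + (is B z + is C z)
  split z with z ≟ A | z ≟ B | z ≟ C
  ... | yes refl | yes refl | _        = contradiction refl A≢B
  ... | yes refl | no  _    | yes refl = contradiction refl A≢C
  ... | no  _    | yes refl | yes refl = contradiction refl B≢C
  ... | yes _    | no  _    | no  _    = refl
  ... | no  _    | yes _    | no  _    = refl
  ... | no  _    | no  _    | yes _    = refl
  ... | no  _    | no  _    | no  _    = refl

Joins : ∀ {A : Set} → A → A → A × A → Set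
Joins x z (p , q) = (p ≡ x × q ≡ z) ⊎ (p ≡ z × q ≡ x)

otherEnd : ∀ {N} → Fin N → Fin N × Fin N → Fin N
otherEnd x (p , q) = if does (x ≟ p) then q else p

joins-otherEnd : ∀ {N} (x p q : Fin N) → does (x ≟ p) ∨ does (x ≟ q) ≡ true → Joins x (otherEnd x (p , q)) (p , q)
joins-otherEnd x p q x∈pq with x ≟ p
... | yes x≡p = inj₁ (sym x≡p , refl)
... | no  _   = inj₂ (refl , sym (does⇒ (x ≟ q) x∈pq))

joins-ends : ∀ {N} {x z p q : Fin N} → Joins x z (p , q) → does (x ≟ p) ∨ does (x ≟ q) ≡ true
joins-ends {x = x} {p = p} (inj₁ (p≡x , _)) = ∨-introˡ (dec-true (x ≟ p) (sym p≡x))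
joins-ends {x = x} {q = q} (inj₂ (_ , q≡x)) = ∨-introʳ (dec-true (x ≟ q) (sym q≡x))

joins⇒otherEnd : ∀ {N} {x z p q : Fin N} → p ≢ q → Joins x z (p , q) → z ≡ otherEnd x (p , q)
joins⇒otherEnd {x = x} {p = p} p≢q (inj₁ (p≡x , q≡z)) rewrite dec-true (x ≟ p) (sym p≡x) = sym q≡z
joins⇒otherEnd {x = x} {p = p} p≢q (inj₂ (p≡z , q≡x)) rewrite dec-false (x ≟ p) (λ x≡p → p≢q (trans (sym x≡p) (sym q≡x))) = sym p≡z

rank : ∀ {m} → (Fin m → Bool) → Fin m → ℕ
rank p zero    = 0
rank p (suc e) = bool→ℕ (p zero) + rank (p ∘ suc) e

rank<count : ∀ m (p : Fin m → Bool) e → p e ≡ true → rank p e < count m p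
rank<count (suc m) p zero    pe rewrite pe = s≤s z≤n
rank<count (suc m) p (suc e) pe = +-monoʳ-< (bool→ℕ (p zero)) (rank<count m (p ∘ suc) e pe)

rank-injective : ∀ m (p : Fin m → Bool) e f → p e ≡ true → p f ≡ true → rank p e ≡ rank p f → e ≡ f
rank-injective (suc m) p zero    zero    _  _  _ = refl
rank-injective (suc m) p zero    (suc f) pe _  eq rewrite pe with () ← eq
rank-injective (suc m) p (suc e) zero    _  pf eq rewrite pf with () ← eq
rank-injective (suc m) p (suc e) (suc f) pe pf eq =
  cong suc (rank-injective m (p ∘ suc) e f pe pf (+-cancelˡ-≡ (bool→ℕ (p zero)) _ _ eq))

rank-surjective : ∀ m (p : Fin m → Bool) k → k < count m p → ∃ λ e → p e ≡ true × rank p e ≡ k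
rank-surjective (suc m) p k k<count with p zero in p0
rank-surjective (suc m) p zero    _            | true = zero , p0 , refl
rank-surjective (suc m) p (suc k) (s≤s k<count) | true
  with e , pe , rank≡k ← rank-surjective m (p ∘ suc) k k<count =
  suc e , pe , trans (cong (λ b → bool→ℕ b + rank (p ∘ suc) e) p0) (cong suc rank≡k)
rank-surjective (suc m) p k k<count | false
  with e , pe , rank≡k ← rank-surjective m (p ∘ suc) k k<count =
  suc e , pe , trans (cong (λ b → bool→ℕ b + rank (p ∘ suc) e) p0) rank≡k

clamp : ∀ {n} → ℕ → Fin (suc n)
clamp {zero}  _       = zero
clamp {suc n} zero    = zero
clamp {suc n} (suc k) = suc (clamp k)

toℕ-clamp : ∀ {n} k → k < suc n → toℕ (clamp {n} k) ≡ k
toℕ-clamp {zero}  zero    _           = refl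
toℕ-clamp {zero}  (suc k) (s≤s ())
toℕ-clamp {suc n} zero    _           = refl
toℕ-clamp {suc n} (suc k) (s≤s k<sn) = cong suc (toℕ-clamp k k<sn)

clamp-toℕ : ∀ {n} (i : Fin (suc n)) → clamp (toℕ i) ≡ i
clamp-toℕ i = toℕ-injective (toℕ-clamp (toℕ i) (toℕ<n i))

%2-cases : ∀ k → k % 2 ≡ 0 ⊎ k % 2 ≡ 1
%2-cases k with k % 2 | m%n<n k 2
... | 0           | _ = inj₁ refl
... | 1           | _ = inj₂ refl
... | suc (suc _) | s≤s (s≤s ())

odd⇒positive : ∀ c d k → c + 2 * d ≡ suc (2 * k) → 1 ≤ c
odd⇒positive zero    d k 2d≡odd = contradiction 2d≡odd (even≢odd d k)
odd⇒positive (suc c) d k _      = s≤s z≤n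

%2≡0⇒*%2≡0 : ∀ n k → n % 2 ≡ 0 → (n * k) % 2 ≡ 0
%2≡0⇒*%2≡0 n k even = trans (%-distribˡ-* n k 2) (cong (λ r → (r * (k % 2)) % 2) even)

%2≡0⇒≥2 : ∀ {n} → n % 2 ≡ 0 → Fin n → 2 ≤ n
%2≡0⇒≥2 {suc zero}    () _
%2≡0⇒≥2 {suc (suc n)} _  _ = s≤s (s≤s z≤n)

xor-triangle : ∀ a b c → bool→ℕ (a xor c) ≤ bool→ℕ (a xor b) + bool→ℕ (b xor c)
xor-triangle true  _     true  = z≤n
xor-triangle false _     false = z≤n
xor-triangle true  true  false = s≤s z≤n
xor-triangle true  false false = s≤s z≤n
xor-triangle false true  true  = s≤s z≤n
xor-triangle false false true  = s≤s z≤n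

xor-path : ∀ a b c d → bool→ℕ (a xor d) ≤ bool→ℕ (b xor c) + (bool→ℕ (b xor a) + bool→ℕ (c xor d))
xor-path a b c d = begin
  bool→ℕ (a xor d)                                    ≤⟨ xor-triangle a b d ⟩
  bool→ℕ (a xor b) + bool→ℕ (b xor d)                 ≤⟨ +-monoʳ-≤ (bool→ℕ (a xor b)) (xor-triangle b c d) ⟩
  bool→ℕ (a xor b) + (bool→ℕ (b xor c) + bool→ℕ (c xor d)) ≡⟨ cong (λ x → bool→ℕ x + _) (xor-comm a b) ⟩
  bool→ℕ (b xor a) + (bool→ℕ (b xor c) + bool→ℕ (c xor d)) ≡⟨ x∙yz≈y∙xz (bool→ℕ (b xor a)) (bool→ℕ (b xor c)) (bool→ℕ (c xor d)) ⟩
  bool→ℕ (b xor c) + (bool→ℕ (b xor a) + bool→ℕ (c xor d)) ∎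
  where open ≤-Reasoning

not-xor-not : ∀ a b → not a xor not b ≡ a xor b
not-xor-not true  b = refl
not-xor-not false true  = refl
not-xor-not false false = refl

∈?-∁ : ∀ {N} (x : Fin N) (S : Subset N) → does (x ∈? ∁ S) ≡ not (does (x ∈? S))
∈?-∁ x S with x ∈? S
... | yes x∈S = dec-false (x ∈? ∁ S) (λ x∈∁S → x∈∁p⇒x∉p x∈∁S x∈S)
... | no  x∉S = dec-true (x ∈? ∁ S) (x∉p⇒x∈∁p x∉S)

∈?-tabulate : ∀ {N} (f : Fin N → Bool) x → does (x ∈? tabulate f) ≡ f x
∈?-tabulate f x with x ∈? tabulate f | f x in fx
... | yes x∈T | _     = trans (sym ([]=⇒lookup x∈T)) (trans (lookup∘tabulate f x) fx)
... | no  x∉T | true  = contradiction (lookup⇒[]= x _ (trans (lookup∘tabulate f x) fx)) x∉T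
... | no  x∉T | false = refl

∈-tabulate : ∀ {N} (f : Fin N → Bool) {x} → f x ≡ true → x ∈ tabulate f
∈-tabulate f {x} fx = does⇒ (x ∈? tabulate f) (trans (∈?-tabulate f x) fx)

∉-tabulate : ∀ {N} (f : Fin N → Bool) {x} → f x ≡ false → x ∈ ∁ (tabulate f)
∉-tabulate f {x} fx = x∉p⇒x∈∁p (does⇒¬ (x ∈? tabulate f) (trans (∈?-tabulate f x) fx))

∀-Subset? : ∀ {n} {P : Subset n → Set} → (∀ T → Dec (P T)) → Dec (∀ T → P T)
∀-Subset? P? = map′ (λ ¬∃¬P T → decidable-stable (P? T) (λ ¬PT → ¬∃¬P (T , ¬PT)))
                    (λ ∀P (T , ¬PT) → ¬PT (∀P T))
                    (¬? (anySubset? (¬? ∘ P?)))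

module _ (G : Multigraph) where
  open Multigraph G

  cutSize-∁ : ∀ S → cutSize G (∁ S) ≡ cutSize G S
  cutSize-∁ S = count-cong m λ e →
    trans (cong₂ _xor_ (∈?-∁ (proj₁ (ends e)) S) (∈?-∁ (proj₂ (ends e)) S))
          (not-xor-not (does (proj₁ (ends e) ∈? S)) (does (proj₂ (ends e) ∈? S)))

  cutSize-⊤ : cutSize G ⊤ ≡ 0
  cutSize-⊤ = trans (count-cong m λ e → cong₂ _xor_ (dec-true (proj₁ (ends e) ∈? ⊤) ∈⊤)
                                                  (dec-true (proj₂ (ends e) ∈? ⊤) ∈⊤))
                    (noEdges m)
    where
    noEdges : ∀ k → count k (λ _ → false) ≡ 0
    noEdges zero    = refl
    noEdges (suc k) = noEdges k

  rGraph-evenOrder : ∀ {r} → 0 < r → IsRGraph G r → n % 2 ≡ 0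
  rGraph-evenOrder 0<r (_ , oddCut) with %2-cases n
  ... | inj₁ even = even
  ... | inj₂ odd  = contradiction (≤-trans 0<r (≤-trans (oddCut ⊤ (trans (cong (_% 2) (∣⊤∣≡n n)) odd))
                                                        (≤-reflexive cutSize-⊤))) λ ()

  edgeConnected⇒rGraph : ∀ {r} → n % 2 ≡ 0 → Regular G r → EdgeConnected G r → IsRGraph G r
  edgeConnected⇒rGraph even reg conn = reg , λ S odd → conn S (nonempty S odd) (coNonempty S odd)
    where
    nonempty : ∀ S → ∣ S ∣ % 2 ≡ 1 → Nonempty S
    nonempty S odd with nonempty? S
    ... | yes ne = ne
    ... | no  ¬ne = contradiction (trans (cong (_% 2) (sym (∣⊥∣≡0 n)))
                                    (trans (cong (λ T → ∣ T ∣ % 2) (sym (Empty-unique ¬ne))) odd)) λ ()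
    coNonempty : ∀ S → ∣ S ∣ % 2 ≡ 1 → Nonempty (∁ S)
    coNonempty S odd with nonempty? (∁ S)
    ... | yes ne = ne
    ... | no  ¬ne = contradiction (trans (sym even) (trans (cong (_% 2) (sym (∣⊤∣≡n n)))
                                    (trans (cong (λ T → ∣ T ∣ % 2) (sym S≡⊤)) odd))) λ ()
      where
      S≡⊤ : S ≡ ⊤
      S≡⊤ = ⊆-antisym (λ _ → ∈⊤) (λ {x} _ → x∉∁p⇒x∈p (λ x∈∁S → ¬ne (x , x∈∁S)))

-- The doubled pentagon

next prev : Fin 5 → Fin 5
next zero                         = suc zero
next (suc zero)                   = suc (suc zero)
next (suc (suc zero))             = suc (suc (suc zero))
next (suc (suc (suc zero)))       = suc (suc (suc (suc zero)))
next (suc (suc (suc (suc zero)))) = zero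
prev zero                         = suc (suc (suc (suc zero)))
prev (suc zero)                   = zero
prev (suc (suc zero))             = suc zero
prev (suc (suc (suc zero)))       = suc (suc zero)
prev (suc (suc (suc (suc zero)))) = suc (suc (suc zero))

next≢ : ∀ i → i ≢ next i
next≢ zero                         ()
next≢ (suc zero)                   ()
next≢ (suc (suc zero))             ()
next≢ (suc (suc (suc zero)))       ()
next≢ (suc (suc (suc (suc zero)))) ()

next-prev : ∀ i → next (prev i) ≡ i
next-prev zero                         = refl
next-prev (suc zero)                   = refl
next-prev (suc (suc zero))             = refl
next-prev (suc (suc (suc zero)))       = refl
next-prev (suc (suc (suc (suc zero)))) = refl

prev-next : ∀ i → prev (next i) ≡ i
prev-next zero                         = refl
prev-next (suc zero)                   = refl
prev-next (suc (suc zero))             = refl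
prev-next (suc (suc (suc zero)))       = refl
prev-next (suc (suc (suc (suc zero)))) = refl

next≢prev : ∀ i → next i ≢ prev i
next≢prev zero                         ()
next≢prev (suc zero)                   ()
next≢prev (suc (suc zero))             ()
next≢prev (suc (suc (suc zero)))       ()
next≢prev (suc (suc (suc (suc zero)))) ()

pentagon-degree : ∀ i → ∑[ j < 5 ] bool→ℕ (does (i ≟ j) ∨ does (i ≟ next j)) ≡ 2
pentagon-degree zero                         = refl
pentagon-degree (suc zero)                   = refl
pentagon-degree (suc (suc zero))             = refl
pentagon-degree (suc (suc (suc zero)))       = refl
pentagon-degree (suc (suc (suc (suc zero)))) = refl

pentagon-edgeEnds : ∀ j → ∑[ i < 5 ] bool→ℕ (does (i ≟ j) ∨ does (i ≟ next j)) ≡ 2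
pentagon-edgeEnds zero                         = refl
pentagon-edgeEnds (suc zero)                   = refl
pentagon-edgeEnds (suc (suc zero))             = refl
pentagon-edgeEnds (suc (suc (suc zero)))       = refl
pentagon-edgeEnds (suc (suc (suc (suc zero)))) = refl

pentagonCut : Subset 5 → ℕ
pentagonCut T = ∑[ i < 5 ] bool→ℕ (lookup T i xor lookup T (next i))

deviation : Subset 5 → Bool → ℕ
deviation T t = ∑[ i < 5 ] bool→ℕ (lookup T i xor t)

pentagonCut-proper : ∀ T → Nonempty T → Nonempty (∁ T) → 2 ≤ pentagonCut T
pentagonCut-proper = from-yes (∀-Subset? λ T → nonempty? T →-dec nonempty? (∁ T) →-dec 2 ≤? pentagonCut T)

deviation≤pentagonCut : ∀ T → deviation T (does (nonempty? T)) ≤ 2 * pentagonCut T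
deviation≤pentagonCut = from-yes (∀-Subset? λ T → deviation T (does (nonempty? T)) ≤? 2 * pentagonCut T)

-- Each vertex v of G becomes a pentagon of nodes node v i whose sides {j , next j} are doubled
-- (inner v c j for c : Fin 2); the five edges at v are attached one to each node, e to node v (slot v e).
module PentagonBlowUp (G : Multigraph) (reg : Regular G 5) where
  open Multigraph G

  edgesAt : Fin n → Fin m → Bool
  edgesAt v e = incident G e v

  -- slot v e is meaningful only for e incident with v.
  slot : Fin n → Fin m → Fin 5
  slot v e = clamp (rank (edgesAt v) e)

  node : Fin n → Fin 5 → Fin (n * 5)
  node = combine

  end₁ end₂ : Fin m → Fin (n * 5)
  end₁ e = node (proj₁ (ends e)) (slot (proj₁ (ends e)) e)
  end₂ e = node (proj₂ (ends e)) (slot (proj₂ (ends e)) e)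

  outer : Fin m → Fin (m + n * 10)
  outer e = e ↑ˡ (n * 10)

  inner : Fin n → Fin 2 → Fin 5 → Fin (m + n * 10)
  inner v c j = m ↑ʳ combine v (combine c j)

  innerEnds : Fin (n * 10) → Fin (n * 5) × Fin (n * 5)
  innerEnds y = let v , cj = remQuot {n} 10 y ; j = proj₂ (remQuot {2} 5 cj) in node v j , node v (next j)

  ends′ : Fin (m + n * 10) → Fin (n * 5) × Fin (n * 5)
  ends′ x = [ (λ e → end₁ e , end₂ e) , innerEnds ]′ (splitAt m x)

  node-injectiveˡ : ∀ {u k w l} → node u k ≡ node w l → u ≡ w
  node-injectiveˡ = combine-injectiveˡ _ _ _ _

  end₁≢end₂ : ∀ e → end₁ e ≢ end₂ e
  end₁≢end₂ e = noLoop e ∘ node-injectiveˡ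

  noLoop′ : ∀ x → proj₁ (ends′ x) ≢ proj₂ (ends′ x)
  noLoop′ x with splitAt m x
  ... | inj₁ e = end₁≢end₂ e
  ... | inj₂ y = next≢ _ ∘ combine-injectiveʳ (proj₁ (remQuot {n} 10 y)) _ (proj₁ (remQuot {n} 10 y)) _

  G′ : Multigraph
  G′ = record { n = n * 5 ; m = m + n * 10 ; ends = ends′ ; noLoop = noLoop′ }

  ends′-outer : ∀ e → ends′ (outer e) ≡ (end₁ e , end₂ e)
  ends′-outer e = cong [ (λ e → end₁ e , end₂ e) , innerEnds ]′ (splitAt-↑ˡ m e (n * 10))

  ends′-inner : ∀ v c j → ends′ (inner v c j) ≡ (node v j , node v (next j))
  ends′-inner v c j = begin
    ends′ (inner v c j)                  ≡⟨ cong [ (λ e → end₁ e , end₂ e) , innerEnds ]′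
                                                 (splitAt-↑ʳ m (n * 10) (combine v (combine c j))) ⟩
    innerEnds (combine v (combine c j))  ≡⟨ cong (λ (u , cj) → let j = proj₂ (remQuot {2} 5 cj) in node u j , node u (next j))
                                                 (remQuot-combine v (combine c j)) ⟩
    let j′ = proj₂ (remQuot {2} 5 (combine c j)) in node v j′ , node v (next j′)
                                         ≡⟨ cong (λ (_ , j′) → node v j′ , node v (next j′)) (remQuot-combine c j) ⟩
    node v j , node v (next j)           ∎
    where open ≡-Reasoning

  ∑-edges′ : (f : Fin (m + n * 10) → ℕ) →
             sum f ≡ ∑[ e < m ] f (outer e) + ∑[ v < n ] ∑[ c < 2 ] ∑[ j < 5 ] f (inner v c j)
  ∑-edges′ f = trans (∑-↑ m (n * 10) f) (cong (∑[ e < m ] f (outer e) +_)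
    (trans (∑-combine n 10 (λ y → f (m ↑ʳ y))) (sum-cong-≗ λ v → ∑-combine 2 5 (λ cj → f (m ↑ʳ combine {n} {10} v cj)))))

  node-on-outer : ∀ e v i → does (node v i ≟ end₁ e) ∨ does (node v i ≟ end₂ e) ≡ incident G e v ∧ does (i ≟ slot v e)
  node-on-outer e v i = trans (cong₂ _∨_ (combine-≟ v a i _) (combine-≟ v b i _)) atEndpoint
    where
    a = proj₁ (ends e)
    b = proj₂ (ends e)
    atEndpoint : (does (v ≟ a) ∧ does (i ≟ slot a e)) ∨ (does (v ≟ b) ∧ does (i ≟ slot b e))
                 ≡ incident G e v ∧ does (i ≟ slot v e)
    atEndpoint with v ≟ a | v ≟ b
    ... | yes refl | yes v≡b  = ⊥-elim (noLoop e v≡b)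
    ... | yes refl | no  _    = ∨-identityʳ _
    ... | no  _    | yes refl = refl
    ... | no  _    | no  _    = refl

  incident-outer : ∀ e v i → incident G′ (outer e) (node v i) ≡ incident G e v ∧ does (i ≟ slot v e)
  incident-outer e v i =
    trans (cong (λ (x , y) → does (node v i ≟ x) ∨ does (node v i ≟ y)) (ends′-outer e)) (node-on-outer e v i)

  incident-inner : ∀ u c j v i →
    incident G′ (inner u c j) (node v i) ≡ does (v ≟ u) ∧ (does (i ≟ j) ∨ does (i ≟ next j))
  incident-inner u c j v i = begin
    incident G′ (inner u c j) (node v i)
      ≡⟨ cong (λ (x , y) → does (node v i ≟ x) ∨ does (node v i ≟ y)) (ends′-inner u c j) ⟩
    does (node v i ≟ node u j) ∨ does (node v i ≟ node u (next j))
      ≡⟨ cong₂ _∨_ (combine-≟ v u i j) (combine-≟ v u i (next j)) ⟩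
    (does (v ≟ u) ∧ does (i ≟ j)) ∨ (does (v ≟ u) ∧ does (i ≟ next j))
      ≡⟨ ∧-distribˡ-∨ (does (v ≟ u)) _ _ ⟨
    does (v ≟ u) ∧ (does (i ≟ j) ∨ does (i ≟ next j))
      ∎
    where open ≡-Reasoning

  toℕ-slot : ∀ v e → incident G e v ≡ true → toℕ (slot v e) ≡ rank (edgesAt v) e
  toℕ-slot v e e∼v = toℕ-clamp _ (subst (rank (edgesAt v) e <_) (reg v) (rank<count m (edgesAt v) e e∼v))

  portEdge-spec : ∀ v i → ∃ λ e → incident G e v ≡ true × rank (edgesAt v) e ≡ toℕ i
  portEdge-spec v i = rank-surjective m (edgesAt v) (toℕ i) (subst (toℕ i <_) (sym (reg v)) (toℕ<n i))

  portEdge : Fin n → Fin 5 → Fin m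
  portEdge v i = proj₁ (portEdge-spec v i)

  portEdge-incident : ∀ v i → incident G (portEdge v i) v ≡ true
  portEdge-incident v i = proj₁ (proj₂ (portEdge-spec v i))

  rank-portEdge : ∀ v i → rank (edgesAt v) (portEdge v i) ≡ toℕ i
  rank-portEdge v i = proj₂ (proj₂ (portEdge-spec v i))

  slot-portEdge : ∀ v i → slot v (portEdge v i) ≡ i
  slot-portEdge v i = trans (cong clamp (rank-portEdge v i)) (clamp-toℕ i)

  portEdge-unique : ∀ v i e → incident G e v ≡ true → slot v e ≡ i → e ≡ portEdge v i
  portEdge-unique v i e e∼v slot≡i = rank-injective m (edgesAt v) e (portEdge v i) e∼v (portEdge-incident v i)
    (trans (sym (toℕ-slot v e e∼v)) (trans (cong toℕ slot≡i) (sym (rank-portEdge v i))))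

  outerDegree : ∀ v i → count m (λ e → incident G e v ∧ does (i ≟ slot v e)) ≡ 1
  outerDegree v i = count≡1 m _ (portEdge v i)
    (cong₂ _∧_ (portEdge-incident v i) (dec-true (i ≟ slot v (portEdge v i)) (sym (slot-portEdge v i))))
    λ e h → let e∼v , i≟slot = ∧-≡true h in portEdge-unique v i e e∼v (sym (does⇒ (i ≟ slot v e) i≟slot))

  -- degreeIn (λ _ → true) is degree G′, and degreeIn (λ y → does (y ∈? M)) is the count in
  -- PerfectMatching G′ M, both definitionally.
  degreeIn : (Fin (m + n * 10) → Bool) → Fin (n * 5) → ℕ
  degreeIn μ x = count (m + n * 10) (λ y → μ y ∧ incident G′ y x)

  degreeIn-node : ∀ μ v i → degreeIn μ (node v i) ≡
      ∑[ e < m ] bool→ℕ (μ (outer e) ∧ (incident G e v ∧ does (i ≟ slot v e)))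
    + ∑[ c < 2 ] ∑[ j < 5 ] bool→ℕ (μ (inner v c j) ∧ (does (i ≟ j) ∨ does (i ≟ next j)))
  degreeIn-node μ v i = begin
    degreeIn μ (node v i)
      ≡⟨ count≡∑ (m + n * 10) (λ x → μ x ∧ incident G′ x (node v i)) ⟩
    ∑[ x < m + n * 10 ] inc x
      ≡⟨ ∑-edges′ inc ⟩
    ∑[ e < m ] inc (outer e) + ∑[ u < n ] ∑[ c < 2 ] ∑[ j < 5 ] inc (inner u c j)
      ≡⟨ cong₂ _+_ (sum-cong-≗ λ e → cong (λ b → bool→ℕ (μ (outer e) ∧ b)) (incident-outer e v i))
                   (∑-supported _ v λ u u≢v → ∑-zero _ λ c → ∑-zero _ λ j → offPentagon u c j u≢v) ⟩
    ∑[ e < m ] bool→ℕ (μ (outer e) ∧ (incident G e v ∧ does (i ≟ slot v e)))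
      + ∑[ c < 2 ] ∑[ j < 5 ] inc (inner v c j)
      ≡⟨ cong (∑[ e < m ] bool→ℕ (μ (outer e) ∧ (incident G e v ∧ does (i ≟ slot v e))) +_)
              (sum-cong-≗ λ c → sum-cong-≗ λ j → onPentagon c j) ⟩
    ∑[ e < m ] bool→ℕ (μ (outer e) ∧ (incident G e v ∧ does (i ≟ slot v e)))
      + ∑[ c < 2 ] ∑[ j < 5 ] bool→ℕ (μ (inner v c j) ∧ (does (i ≟ j) ∨ does (i ≟ next j)))
      ∎
    where
    open ≡-Reasoning
    inc : Fin (m + n * 10) → ℕ
    inc x = bool→ℕ (μ x ∧ incident G′ x (node v i))
    offPentagon : ∀ u c j → u ≢ v → inc (inner u c j) ≡ 0
    offPentagon u c j u≢v = cong bool→ℕ (trans (cong (μ (inner u c j) ∧_) (incident-inner u c j v i))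
      (trans (cong (λ b → μ (inner u c j) ∧ (b ∧ (does (i ≟ j) ∨ does (i ≟ next j)))) (dec-false (v ≟ u) (u≢v ∘ sym)))
             (∧-zeroʳ (μ (inner u c j)))))
    onPentagon : ∀ c j → inc (inner v c j) ≡ bool→ℕ (μ (inner v c j) ∧ (does (i ≟ j) ∨ does (i ≟ next j)))
    onPentagon c j = cong bool→ℕ (trans (cong (μ (inner v c j) ∧_) (incident-inner v c j v i))
      (cong (λ b → μ (inner v c j) ∧ (b ∧ (does (i ≟ j) ∨ does (i ≟ next j)))) (≟-refl v)))

  regular′ : Regular G′ 5
  regular′ x = subst (λ y → degree G′ y ≡ 5) (combine-remQuot {n} 5 x) (degree-node _ _)
    where
    degree-node : ∀ v i → degree G′ (node v i) ≡ 5
    degree-node v i = begin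
      degree G′ (node v i)
        ≡⟨ degreeIn-node (λ _ → true) v i ⟩
      ∑[ e < m ] bool→ℕ (incident G e v ∧ does (i ≟ slot v e))
        + ∑[ c < 2 ] ∑[ j < 5 ] bool→ℕ (does (i ≟ j) ∨ does (i ≟ next j))
        ≡⟨ cong₂ _+_ (trans (sym (count≡∑ m _)) (outerDegree v i)) (sum-cong-≗ {2} λ _ → pentagon-degree i) ⟩
      5 ∎
      where open ≡-Reasoning

  edgesAtIn : (Fin (m + n * 10) → Bool) → Fin n → ℕ
  edgesAtIn μ v = ∑[ e < m ] bool→ℕ (μ (outer e) ∧ incident G e v)

  pentagonEdgesIn : (Fin (m + n * 10) → Bool) → Fin n → ℕ
  pentagonEdgesIn μ v = ∑[ c < 2 ] ∑[ j < 5 ] bool→ℕ (μ (inner v c j))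

  ∑-degreeIn-pentagon : ∀ μ v →
    ∑[ i < 5 ] degreeIn μ (node v i) ≡ edgesAtIn μ v + 2 * pentagonEdgesIn μ v
  ∑-degreeIn-pentagon μ v = begin
    ∑[ i < 5 ] degreeIn μ (node v i)
      ≡⟨ sum-cong-≗ (degreeIn-node μ v) ⟩
    ∑[ i < 5 ] (∑[ e < m ] out i e + ∑[ c < 2 ] ∑[ j < 5 ] pen i c j)
      ≡⟨ ∑-distrib-+ (λ i → ∑[ e < m ] out i e) (λ i → ∑[ c < 2 ] ∑[ j < 5 ] pen i c j) ⟩
    ∑[ i < 5 ] ∑[ e < m ] out i e + ∑[ i < 5 ] ∑[ c < 2 ] ∑[ j < 5 ] pen i c j
      ≡⟨ cong₂ _+_ (∑-comm out) (trans (∑-comm (λ i c → ∑[ j < 5 ] pen i c j)) (sum-cong-≗ λ c → ∑-comm (λ i j → pen i c j))) ⟩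
    ∑[ e < m ] ∑[ i < 5 ] out i e + ∑[ c < 2 ] ∑[ j < 5 ] ∑[ i < 5 ] pen i c j
      ≡⟨ cong₂ _+_ (sum-cong-≗ outerOnce) (sum-cong-≗ λ c → sum-cong-≗ λ j → innerTwice c j) ⟩
    edgesAtIn μ v + ∑[ c < 2 ] ∑[ j < 5 ] (bool→ℕ (μ (inner v c j)) + bool→ℕ (μ (inner v c j)))
      ≡⟨ cong (edgesAtIn μ v +_) (trans (sum-cong-≗ λ c → ∑-distrib-+ (inPentagon c) (inPentagon c))
                                         (∑-distrib-+ (sum ∘ inPentagon) (sum ∘ inPentagon))) ⟩
    edgesAtIn μ v + (pentagonEdgesIn μ v + pentagonEdgesIn μ v)
      ≡⟨ cong (λ d → edgesAtIn μ v + (pentagonEdgesIn μ v + d)) (+-identityʳ (pentagonEdgesIn μ v)) ⟨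
    edgesAtIn μ v + 2 * pentagonEdgesIn μ v
      ∎
    where
    open ≡-Reasoning
    out : Fin 5 → Fin m → ℕ
    out i e = bool→ℕ (μ (outer e) ∧ (incident G e v ∧ does (i ≟ slot v e)))
    pen : Fin 5 → Fin 2 → Fin 5 → ℕ
    pen i c j = bool→ℕ (μ (inner v c j) ∧ (does (i ≟ j) ∨ does (i ≟ next j)))
    inPentagon : Fin 2 → Fin 5 → ℕ
    inPentagon c j = bool→ℕ (μ (inner v c j))
    outerOnce : ∀ e → ∑[ i < 5 ] out i e ≡ bool→ℕ (μ (outer e) ∧ incident G e v)
    outerOnce e = trans (sum-cong-≗ λ i → cong bool→ℕ (sym (∧-assoc (μ (outer e)) (incident G e v) (does (i ≟ slot v e)))))
                        (∑-at (λ _ → μ (outer e) ∧ incident G e v) (slot v e))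
    innerTwice : ∀ c j → ∑[ i < 5 ] pen i c j ≡ bool→ℕ (μ (inner v c j)) + bool→ℕ (μ (inner v c j))
    innerTwice c j with μ (inner v c j)
    ... | true  = pentagon-edgeEnds j
    ... | false = refl

  restrict : Subset (m + n * 10) → Subset m
  restrict M = tabulate (λ e → does (outer e ∈? M))

  class1′⇒class1 : Class1 G′ 5 → Class1 G 5
  class1′⇒class1 (Ms , perfect , disjoint) = (λ k → restrict (Ms k)) , perfect′ , disjoint′
    where
    μ : Fin 5 → Fin (m + n * 10) → Bool
    μ k x = does (x ∈? Ms k)

    -- The ends of inner edges in a pentagon come in pairs.
    atLeastOne : ∀ k v → 1 ≤ edgesAtIn (μ k) v
    atLeastOne k v = odd⇒positive (edgesAtIn (μ k) v) (pentagonEdgesIn (μ k) v) 2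
      (trans (sym (∑-degreeIn-pentagon (μ k) v)) (sum-cong-≗ (perfect k ∘ node v)))

    atMostOneMatching : ∀ v e → ∑[ k < 5 ] bool→ℕ (μ k (outer e) ∧ incident G e v) ≤ bool→ℕ (incident G e v)
    atMostOneMatching v e with incident G e v
    ... | false = ≤-reflexive (∑-zero _ λ k → cong bool→ℕ (∧-zeroʳ (μ k (outer e))))
    ... | true  = ≤-trans (≤-reflexive (sum-cong-≗ λ k → cong bool→ℕ (∧-identityʳ (μ k (outer e)))))
                          (∑-pairwiseDisjoint≤1 (λ k → μ k (outer e))
                            λ k l k≢l k∋e l∋e → disjoint k l k≢l (outer e) (does⇒ (_ ∈? Ms k) k∋e , does⇒ (_ ∈? Ms l) l∋e))

    atMostFive : ∀ v → ∑[ k < 5 ] edgesAtIn (μ k) v ≤ 5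
    atMostFive v = begin
      ∑[ k < 5 ] edgesAtIn (μ k) v                                ≡⟨ ∑-comm (λ k e → bool→ℕ (μ k (outer e) ∧ incident G e v)) ⟩
      ∑[ e < m ] ∑[ k < 5 ] bool→ℕ (μ k (outer e) ∧ incident G e v) ≤⟨ ∑-mono-≤ (atMostOneMatching v) ⟩
      ∑[ e < m ] bool→ℕ (incident G e v)                            ≡⟨ trans (sym (count≡∑ m (edgesAt v))) (reg v) ⟩
      5                                                             ∎
      where open ≤-Reasoning

    perfect′ : ∀ k → PerfectMatching G (restrict (Ms k))
    perfect′ k v = begin
      count m (λ e → does (e ∈? restrict (Ms k)) ∧ incident G e v)
        ≡⟨ count≡∑ m _ ⟩
      ∑[ e < m ] bool→ℕ (does (e ∈? restrict (Ms k)) ∧ incident G e v)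
        ≡⟨ sum-cong-≗ (λ e → cong (λ b → bool→ℕ (b ∧ incident G e v)) (∈?-tabulate (λ f → μ k (outer f)) e)) ⟩
      edgesAtIn (μ k) v
        ≡⟨ ∑-positive≤length⇒≡1 (λ l → edgesAtIn (μ l) v) (λ l → atLeastOne l v) (atMostFive v) k ⟩
      1 ∎
      where open ≡-Reasoning

    disjoint′ : ∀ k l → k ≢ l → (e : Fin m) → ¬ (e ∈ restrict (Ms k) × e ∈ restrict (Ms l))
    disjoint′ k l k≢l e (e∈k , e∈l) = disjoint k l k≢l (outer e) (lift k e∈k , lift l e∈l)
      where
      lift : ∀ k → e ∈ restrict (Ms k) → outer e ∈ Ms k
      lift k e∈ = does⇒ (outer e ∈? Ms k) (trans (sym (∈?-tabulate (λ f → μ k (outer f)) e)) (dec-true (e ∈? restrict (Ms k)) e∈))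

  -- The underlying simple graph

  edge′-cases : ∀ y → (∃ λ e → y ≡ outer e) ⊎ (∃ λ v → ∃ λ c → ∃ λ j → y ≡ inner v c j)
  edge′-cases y with splitAt m y in split≡
  ... | inj₁ e = inj₁ (e , trans (sym (join-splitAt m (n * 10) y)) (cong (join m (n * 10)) split≡))
  ... | inj₂ w = inj₂ (v , c , j , (begin
    y                                ≡⟨ join-splitAt m (n * 10) y ⟨
    join m (n * 10) (splitAt m y)    ≡⟨ cong (join m (n * 10)) split≡ ⟩
    m ↑ʳ w                           ≡⟨ cong (m ↑ʳ_) (combine-remQuot {n} 10 w) ⟨
    m ↑ʳ combine v cj                ≡⟨ cong (λ cj → m ↑ʳ combine v cj) (combine-remQuot {2} 5 cj) ⟨
    inner v c j                      ∎))
    where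
    open ≡-Reasoning
    v = proj₁ (remQuot {n} 10 w)
    cj = proj₂ (remQuot {n} 10 w)
    c = proj₁ (remQuot {2} 5 cj)
    j = proj₂ (remQuot {2} 5 cj)

  far : Fin n → Fin 5 → Fin (n * 5)
  far v i = otherEnd (node v i) (end₁ (portEdge v i) , end₂ (portEdge v i))

  portEdge-joins : ∀ v i → Joins (node v i) (far v i) (end₁ (portEdge v i) , end₂ (portEdge v i))
  portEdge-joins v i = joins-otherEnd (node v i) _ _ (trans (node-on-outer (portEdge v i) v i)
    (cong₂ _∧_ (portEdge-incident v i) (dec-true (i ≟ slot v (portEdge v i)) (sym (slot-portEdge v i)))))

  outer-at-node : ∀ e v i z → Joins (node v i) z (end₁ e , end₂ e) → e ≡ portEdge v i
  outer-at-node e v i z joins =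
    let e∼v , i≟slot = ∧-≡true (trans (sym (node-on-outer e v i)) (joins-ends joins))
    in portEdge-unique v i e e∼v (sym (does⇒ (i ≟ slot v e) i≟slot))

  far-outside : ∀ v i j → far v i ≢ node v j
  far-outside v i j far≡node with portEdge-joins v i
  ... | inj₁ (end₁≡ , end₂≡far) =
    noLoop (portEdge v i) (trans (node-injectiveˡ end₁≡) (sym (node-injectiveˡ (trans end₂≡far far≡node))))
  ... | inj₂ (end₁≡far , end₂≡) =
    noLoop (portEdge v i) (trans (node-injectiveˡ (trans end₁≡far far≡node)) (sym (node-injectiveˡ end₂≡)))

  neighbour : Fin n → Fin 5 → Fin (n * 5) → Bool
  neighbour v i = isOneOf (node v (next i)) (node v (prev i)) (far v i)

  inner-neighbour : ∀ v i u j z → Joins (node v i) z (node u j , node u (next j)) →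
                    z ≡ node v (next i) ⊎ z ≡ node v (prev i)
  inner-neighbour v i u j z (inj₁ (uj≡vi , unj≡z))
    with refl ← combine-injectiveˡ u j v i uj≡vi | refl ← combine-injectiveʳ u j v i uj≡vi = inj₁ (sym unj≡z)
  inner-neighbour v i u j z (inj₂ (uj≡z , unj≡vi))
    with refl ← combine-injectiveˡ u (next j) v i unj≡vi | refl ← combine-injectiveʳ u (next j) v i unj≡vi
    = inj₂ (trans (sym uj≡z) (cong (node u) (sym (prev-next j))))

  adjacent⇒neighbour : ∀ v i z → Adjacent G′ (node v i) z → neighbour v i z ≡ true
  adjacent⇒neighbour v i z (y , joins) with edge′-cases y
  ... | inj₁ (e , refl) = subst (λ z → neighbour v i z ≡ true) (sym z≡far) (isOneOf-third _ _ (far v i))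
    where
    joins′ = subst (Joins (node v i) z) (ends′-outer e) joins
    z≡far : z ≡ far v i
    z≡far = trans (joins⇒otherEnd (end₁≢end₂ e) joins′)
                  (cong (λ f → otherEnd (node v i) (end₁ f , end₂ f)) (outer-at-node e v i z joins′))
  ... | inj₂ (u , c , j , refl) with inner-neighbour v i u j z (subst (Joins (node v i) z) (ends′-inner u c j) joins)
  ...   | inj₁ z≡next = subst (λ z → neighbour v i z ≡ true) (sym z≡next) (isOneOf-first (node v (next i)) _ _)
  ...   | inj₂ z≡prev = subst (λ z → neighbour v i z ≡ true) (sym z≡prev) (isOneOf-second _ (node v (prev i)) _)

  neighbour⇒adjacent : ∀ v i z → neighbour v i z ≡ true → Adjacent G′ (node v i) z
  neighbour⇒adjacent v i z isNeighbour with ∨-≡true isNeighbour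
  ... | inj₁ z≟next = inner v zero i ,
          inj₁ (cong proj₁ (ends′-inner v zero i) , trans (cong proj₂ (ends′-inner v zero i)) (sym (does⇒ (z ≟ _) z≟next)))
  ... | inj₂ rest with ∨-≡true rest
  ...   | inj₁ z≟prev = inner v zero (prev i) ,
          inj₂ (trans (cong proj₁ (ends′-inner v zero (prev i))) (sym (does⇒ (z ≟ _) z≟prev)) ,
                trans (cong proj₂ (ends′-inner v zero (prev i))) (cong (node v) (next-prev i)))
  ...   | inj₂ z≟far rewrite does⇒ (z ≟ far v i) z≟far =
          outer (portEdge v i) , subst (Joins (node v i) (far v i)) (sym (ends′-outer (portEdge v i))) (portEdge-joins v i)

  cubic′ : UnderlyingCubic G′
  cubic′ x = subst (λ y → simpleDegree G′ y ≡ 3) (combine-remQuot {n} 5 x) (simpleDegree-node _ _)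
    where
    simpleDegree-node : ∀ v i → simpleDegree G′ (node v i) ≡ 3
    simpleDegree-node v i = trans
      (count-cong (n * 5) λ z → does-≡ (adjacent? G′ (node v i) z) (adjacent⇒neighbour v i z) (neighbour⇒adjacent v i z))
      (count-isOneOf (next≢prev i ∘ combine-injectiveʳ v (next i) v (prev i))
                   (far-outside v i (next i) ∘ sym) (far-outside v i (prev i) ∘ sym))

  -- Edge-connectivity

  trace : Subset (n * 5) → Fin n → Subset 5
  trace S v = tabulate (λ i → does (node v i ∈? S))

  ∈-trace⁺ : ∀ S v i → node v i ∈ S → i ∈ trace S v
  ∈-trace⁺ S v i vi∈S = ∈-tabulate (λ j → does (node v j ∈? S)) (dec-true (node v i ∈? S) vi∈S)

  ∈-trace⁻ : ∀ S v i → i ∈ trace S v → node v i ∈ S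
  ∈-trace⁻ S v i i∈T = does⇒ (node v i ∈? S) (trans (sym (∈?-tabulate (λ j → does (node v j ∈? S)) i)) (dec-true (i ∈? trace S v) i∈T))

  trace-∁ : ∀ S v → Nonempty (trace (∁ S) v) → Nonempty (∁ (trace S v))
  trace-∁ S v (i , i∈) = i , x∉p⇒x∈∁p (x∈∁p⇒x∉p (∈-trace⁻ (∁ S) v i i∈) ∘ ∈-trace⁻ S v i)

  outerCut : Subset (n * 5) → ℕ
  outerCut S = ∑[ e < m ] bool→ℕ (does (end₁ e ∈? S) xor does (end₂ e ∈? S))

  cutSize′ : ∀ S → cutSize G′ S ≡ outerCut S + ∑[ v < n ] (2 * pentagonCut (trace S v))
  cutSize′ S = begin
    cutSize G′ S
      ≡⟨ count≡∑ (m + n * 10) _ ⟩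
    ∑[ y < m + n * 10 ] crosses (ends′ y)
      ≡⟨ ∑-edges′ (crosses ∘ ends′) ⟩
    ∑[ e < m ] crosses (ends′ (outer e)) + ∑[ v < n ] ∑[ c < 2 ] ∑[ j < 5 ] crosses (ends′ (inner v c j))
      ≡⟨ cong₂ _+_ (sum-cong-≗ (cong crosses ∘ ends′-outer))
                   (sum-cong-≗ λ v → sum-cong-≗ λ c → sum-cong-≗ λ j → trans (cong crosses (ends′-inner v c j)) (onTrace v j)) ⟩
    outerCut S + ∑[ v < n ] (2 * pentagonCut (trace S v))
      ∎
    where
    open ≡-Reasoning
    crosses : Fin (n * 5) × Fin (n * 5) → ℕ
    crosses (x , y) = bool→ℕ (does (x ∈? S) xor does (y ∈? S))
    onTrace : ∀ v j → crosses (node v j , node v (next j)) ≡ bool→ℕ (lookup (trace S v) j xor lookup (trace S v) (next j))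
    onTrace v j = sym (cong₂ (λ a b → bool→ℕ (a xor b)) (lookup∘tabulate inS j) (lookup∘tabulate inS (next j)))
      where inS = λ i → does (node v i ∈? S)

  nodeOnOneOuterEdge : ∀ x → count m (λ e → does (x ≟ end₁ e) ∨ does (x ≟ end₂ e)) ≡ 1
  nodeOnOneOuterEdge x = subst (λ y → count m (λ e → does (y ≟ end₁ e) ∨ does (y ≟ end₂ e)) ≡ 1)
    (combine-remQuot {n} 5 x) (trans (count-cong m λ e → node-on-outer e v i) (outerDegree v i))
    where
    v = proj₁ (remQuot {n} 5 x)
    i = proj₂ (remQuot {n} 5 x)

  ∑-outerEnds : ∀ (h : Fin (n * 5) → Bool) →
    ∑[ e < m ] (bool→ℕ (h (end₁ e)) + bool→ℕ (h (end₂ e))) ≡ ∑[ x < n * 5 ] bool→ℕ (h x)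
  ∑-outerEnds h = begin
    ∑[ e < m ] (bool→ℕ (h (end₁ e)) + bool→ℕ (h (end₂ e)))
      ≡⟨ sum-cong-≗ (λ e → ∑-twoPoints h (end₁≢end₂ e)) ⟨
    ∑[ e < m ] ∑[ x < n * 5 ] bool→ℕ (h x ∧ (does (x ≟ end₁ e) ∨ does (x ≟ end₂ e)))
      ≡⟨ ∑-comm (λ e x → bool→ℕ (h x ∧ (does (x ≟ end₁ e) ∨ does (x ≟ end₂ e)))) ⟩
    ∑[ x < n * 5 ] ∑[ e < m ] bool→ℕ (h x ∧ (does (x ≟ end₁ e) ∨ does (x ≟ end₂ e)))
      ≡⟨ sum-cong-≗ (λ x → ∑-∧-count≡1 m _ (h x) (nodeOnOneOuterEdge x)) ⟩
    ∑[ x < n * 5 ] bool→ℕ (h x)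
      ∎
    where open ≡-Reasoning

  meets : Subset (n * 5) → Fin n → Bool
  meets S v = does (nonempty? (trace S v))

  -- A cut S of G′ is charged to the cut of G formed by the pentagons meeting S: an edge of G
  -- crossing that cut either crosses S itself or ends at a node whose side differs from its pentagon's.
  cutSize≤cutSize′ : ∀ S → cutSize G (tabulate (meets S)) ≤ cutSize G′ S
  cutSize≤cutSize′ S = begin
    cutSize G (tabulate τ)
      ≡⟨ trans (count-cong m λ e → cong₂ _xor_ (∈?-tabulate τ (a e)) (∈?-tabulate τ (b e))) (count≡∑ m _) ⟩
    ∑[ e < m ] bool→ℕ (τ (a e) xor τ (b e))
      ≤⟨ ∑-mono-≤ (λ e → xor-path (τ (a e)) (s (end₁ e)) (s (end₂ e)) (τ (b e))) ⟩
    ∑[ e < m ] (bool→ℕ (s (end₁ e) xor s (end₂ e)) + (bool→ℕ (s (end₁ e) xor τ (a e)) + bool→ℕ (s (end₂ e) xor τ (b e))))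
      ≡⟨ sum-cong-≗ (λ e → cong (bool→ℕ (s (end₁ e) xor s (end₂ e)) +_)
                                (cong₂ _+_ (cong bool→ℕ (h-node (a e) _)) (cong bool→ℕ (h-node (b e) _)))) ⟨
    ∑[ e < m ] (bool→ℕ (s (end₁ e) xor s (end₂ e)) + (bool→ℕ (h (end₁ e)) + bool→ℕ (h (end₂ e))))
      ≡⟨ ∑-distrib-+ (λ e → bool→ℕ (s (end₁ e) xor s (end₂ e))) (λ e → bool→ℕ (h (end₁ e)) + bool→ℕ (h (end₂ e))) ⟩
    outerCut S + ∑[ e < m ] (bool→ℕ (h (end₁ e)) + bool→ℕ (h (end₂ e)))
      ≡⟨ cong (outerCut S +_) (∑-outerEnds h) ⟩
    outerCut S + ∑[ x < n * 5 ] bool→ℕ (h x)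
      ≡⟨ cong (outerCut S +_) (trans (∑-combine n 5 (bool→ℕ ∘ h)) (sum-cong-≗ λ v → sum-cong-≗ (onTrace v))) ⟩
    outerCut S + ∑[ v < n ] deviation (trace S v) (τ v)
      ≤⟨ +-monoʳ-≤ (outerCut S) (∑-mono-≤ λ v → deviation≤pentagonCut (trace S v)) ⟩
    outerCut S + ∑[ v < n ] (2 * pentagonCut (trace S v))
      ≡⟨ cutSize′ S ⟨
    cutSize G′ S
      ∎
    where
    open ≤-Reasoning
    τ = meets S
    a b : Fin m → Fin n
    a e = proj₁ (ends e)
    b e = proj₂ (ends e)
    s : Fin (n * 5) → Bool
    s x = does (x ∈? S)
    h : Fin (n * 5) → Bool
    h x = s x xor τ (proj₁ (remQuot {n} 5 x))
    h-node : ∀ v i → h (node v i) ≡ s (node v i) xor τ v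
    h-node v i = cong (λ w → s (node v i) xor τ w) (cong proj₁ (remQuot-combine v i))
    onTrace : ∀ v i → bool→ℕ (h (node v i)) ≡ bool→ℕ (lookup (trace S v) i xor τ v)
    onTrace v i = cong bool→ℕ (trans (h-node v i) (cong (_xor τ v) (sym (lookup∘tabulate (λ j → s (node v j)) i))))

  cutSize′-missedPentagon : EdgeConnected G 5 → ∀ S {x} v → x ∈ S → ¬ Nonempty (trace S v) → 5 ≤ cutSize G′ S
  cutSize′-missedPentagon conn S {x} v x∈S missed = ≤-trans
    (conn (tabulate (meets S)) (w , ∈-tabulate (meets S) (dec-true (nonempty? (trace S w)) (i , ∈-trace⁺ S w i wi∈S)))
                               (v , ∉-tabulate (meets S) (dec-false (nonempty? (trace S v)) missed)))
    (cutSize≤cutSize′ S)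
    where
    w = proj₁ (remQuot {n} 5 x)
    i = proj₂ (remQuot {n} 5 x)
    wi∈S : node w i ∈ S
    wi∈S = subst (_∈ S) (sym (combine-remQuot {n} 5 x)) x∈S

  edgeConnected′ : EdgeConnected G 5 → n % 2 ≡ 0 → EdgeConnected G′ 5
  edgeConnected′ conn even S (x , x∈S) (y , y∈∁S) with any? (λ v → ¬? (nonempty? (trace S v)))
  ... | yes (v , missed) = cutSize′-missedPentagon conn S v x∈S missed
  ... | no  noneMissed with any? (λ v → ¬? (nonempty? (trace (∁ S) v)))
  ...   | yes (v , missed) = subst (5 ≤_) (cutSize-∁ G′ S) (cutSize′-missedPentagon conn (∁ S) v y∈∁S missed)
  ...   | no  noneFull = begin
    5                                               ≤⟨ m≤m+n 5 3 ⟩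
    2 * 4                                           ≤⟨ *-monoˡ-≤ 4 (%2≡0⇒≥2 even (proj₁ (remQuot {n} 5 x))) ⟩
    n * 4                                           ≤⟨ ∑-≥-const 4 _ (λ v → *-monoʳ-≤ 2 (split v)) ⟩
    ∑[ v < n ] (2 * pentagonCut (trace S v))        ≤⟨ m≤n+m _ (outerCut S) ⟩
    outerCut S + ∑[ v < n ] (2 * pentagonCut (trace S v)) ≡⟨ cutSize′ S ⟨
    cutSize G′ S                                    ∎
    where
    open ≤-Reasoning
    split : ∀ v → 2 ≤ pentagonCut (trace S v)
    split v = pentagonCut-proper (trace S v)
      (decidable-stable (nonempty? (trace S v)) λ missed → noneMissed (v , missed))
      (trace-∁ S v (decidable-stable (nonempty? (trace (∁ S) v)) λ missed → noneFull (v , missed)))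

theorem5p9 : ((G : Multigraph) → EdgeConnected G 5 → IsRGraph G 5 → Class1 G 5)
             ⇔ ((G : Multigraph) → EdgeConnected G 5 → IsRGraph G 5 → UnderlyingCubic G → Class1 G 5)
theorem5p9 = mk⇔ (λ class1 G conn rGraph _ → class1 G conn rGraph) cubic⇒all
  where
  cubic⇒all : ((G : Multigraph) → EdgeConnected G 5 → IsRGraph G 5 → UnderlyingCubic G → Class1 G 5) →
              (G : Multigraph) → EdgeConnected G 5 → IsRGraph G 5 → Class1 G 5
  cubic⇒all cubicCase G conn rGraph = class1′⇒class1 (cubicCase G′ conn′ rGraph′ cubic′)
    where
    open PentagonBlowUp G (proj₁ rGraph)
    even : Multigraph.n G % 2 ≡ 0
    even = rGraph-evenOrder G (s≤s z≤n) rGraph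
    conn′ : EdgeConnected G′ 5
    conn′ = edgeConnected′ conn even
    rGraph′ : IsRGraph G′ 5
    rGraph′ = edgeConnected⇒rGraph G′ (%2≡0⇒*%2≡0 (Multigraph.n G) 5 even) regular′ conn′
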